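{- Let $G$ be a connected graph with a basis forced vertex $v$, and let $H$ be the graph obtained from $G$ by adding a new vertex $u$ adjacent only to $v$. Then $u$ is a basis forced vertex of $H$ if and only if for every metric basis $R$ of $G$ there exists a vertex $w\in N_G(v)$ such that $d_H(r,w)=d_H(r,u)$ for all $r\in R$.
   Context: Graphs are finite, simple and connected; $d_H(x,y)$ is the distance in $H$ and $N_G(v)$ the open neighbourhood of $v$ in $G$. A set $S\subseteq V(G)$ is a resolving set of $G$ if for every two distinct vertices $x,y$ there is $s\in S$ with $d_G(s,x)\neq d_G(s,y)$. A metric basis is a resolving set of minimum cardinality. A basis forced vertex of $G$ is a vertex belonging to every metric basis of $G$. -}

module Defs where

open import Data.Nat using (ℕ; zero; suc; _≤_)
open import Data.Fin using (Fin; zero; suc; _≟_)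
open import Data.Fin.Subset using (Subset; _∈_; ∣_∣)
open import Data.Bool using (Bool; true; false; _∧_; _∨_; if_then_else_)
open import Data.List using (allFin)
open import Data.Bool.ListAction using (any)
open import Data.Product using (Σ; Σ-syntax; _×_; _,_)
open import Relation.Nullary using (¬_; does)
open import Relation.Binary.PropositionalEquality using (_≡_; _≢_; refl)

record Graph : Set where
  field
    n      : ℕ
    adj    : Fin n → Fin n → Bool
    sym    : ∀ x y → adj x y ≡ adj y x
    irrefl : ∀ x → adj x x ≡ false
open Graph public

reach : (G : Graph) → ℕ → Fin (n G) → Fin (n G) → Bool
reach G zero    x y = does (x ≟ y)
reach G (suc k) x y = reach G k x y ∨ any (λ z → adj G x z ∧ reach G k z y) (allFin (n G))

-- dist G x y = least k (searched in 0..n) with a walk of length ≤ k from x to y,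
-- i.e. the usual shortest-path distance (for connected graphs it is always < n).
distSearch : (G : Graph) → Fin (n G) → Fin (n G) → ℕ → ℕ → ℕ
distSearch G x y k zero    = k
distSearch G x y k (suc f) = if reach G k x y then k else distSearch G x y (suc k) f

dist : (G : Graph) → Fin (n G) → Fin (n G) → ℕ
dist G x y = distSearch G x y 0 (n G)

Connected : Graph → Set
Connected G = ∀ x y → Σ[ k ∈ ℕ ] reach G k x y ≡ true

Resolving : (G : Graph) → Subset (n G) → Set
Resolving G S = ∀ x y → x ≢ y → Σ[ s ∈ Fin (n G) ] (s ∈ S × dist G s x ≢ dist G s y)

MetricBasis : (G : Graph) → Subset (n G) → Set
MetricBasis G S = Resolving G S × (∀ T → Resolving G T → ∣ S ∣ ≤ ∣ T ∣)

BasisForced : (G : Graph) → Fin (n G) → Set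
BasisForced G v = ∀ S → MetricBasis G S → v ∈ S

-- Pendant extension: vertex set Fin (suc n); the new vertex u is `zero`,
-- old vertex x of G is `suc x`; u is adjacent only to (suc v).
pendAdj : (G : Graph) → Fin (n G) → Fin (suc (n G)) → Fin (suc (n G)) → Bool
pendAdj G v zero    zero    = false
pendAdj G v zero    (suc b) = does (b ≟ v)
pendAdj G v (suc a) zero    = does (a ≟ v)
pendAdj G v (suc a) (suc b) = adj G a b

pendSym : (G : Graph) (v : Fin (n G)) → ∀ x y → pendAdj G v x y ≡ pendAdj G v y x
pendSym G v zero    zero    = refl
pendSym G v zero    (suc b) = refl
pendSym G v (suc a) zero    = refl
pendSym G v (suc a) (suc b) = Graph.sym G a b

pendIrrefl : (G : Graph) (v : Fin (n G)) → ∀ x → pendAdj G v x x ≡ false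
pendIrrefl G v zero    = refl
pendIrrefl G v (suc a) = irrefl G a

addPendant : (G : Graph) → Fin (n G) → Graph
addPendant G v = record
  { n = suc (n G) ; adj = pendAdj G v ; sym = pendSym G v ; irrefl = pendIrrefl G v }

newVertex : (G : Graph) (v : Fin (n G)) → Fin (n (addPendant G v))
newVertex G v = zero

old : (G : Graph) (v : Fin (n G)) → Fin (n G) → Fin (n (addPendant G v))
old G v x = suc x

{-# OPTIONS --safe #-}
module Submission where

-- In H = G plus the pendant vertex u at v, distances between old vertices are those of G and
-- d(u, x) = 1 + d(v, x). So u separates no more pairs of old vertices than v does, and exchanging
-- v for u turns a basis of G (which contains v) into a resolving set of H: dim H = dim G.
-- If u is forced in H but some basis R of G had no neighbour w of v mimicking u on R, then R would
-- resolve H (v separates u from every vertex not adjacent to v), making R a basis of H without u.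
-- Conversely a basis S of H without u is a basis of G, and a neighbour mimicking u on S would
-- leave u and w unresolved in H.

open import Defs
open import Data.Nat using (ℕ; zero; suc; _≤_; _<_; _+_; z≤n; s≤s)
import Data.Nat.Properties as ℕ
open import Data.Fin using (Fin; zero; suc; _≟_)
import Data.Fin.Properties as Fin
open import Data.Fin.Subset using (Subset; _∈_; ∣_∣; ⁅_⁆; _∪_; _-_; ⊤; _⊂_)
import Data.Fin.Subset.Properties as Subset
open import Data.Bool using (Bool; true; false; _∧_; _∨_; if_then_else_)
import Data.Bool.Properties as Bool
open import Data.List using (allFin)
open import Data.Bool.ListAction using (any)
import Data.List.Relation.Unary.Any as Any
import Data.List.Relation.Unary.Any.Properties as Any
open import Data.List.Membership.Propositional.Properties using (∈-allFin)
open import Data.Vec using (_∷_; tabulate; here; there)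
import Data.Vec.Properties as Vec
open import Data.Product using (Σ; Σ-syntax; ∃-syntax; _×_; _,_; proj₁)
open import Data.Sum using (_⊎_; inj₁; inj₂)
open import Data.Empty using (⊥-elim)
open import Relation.Nullary using (¬_; Dec; yes; no; does)
open import Relation.Nullary.Decidable using (dec-true; _×-dec_; _→-dec_; ¬?)
open import Relation.Binary.PropositionalEquality using (_≡_; _≢_; refl; trans; cong; subst)
import Relation.Binary.PropositionalEquality as ≡
open import Function.Base using (_∘_; const)
open import Function.Bundles using (_⇔_; mk⇔; Equivalence)

∨≡true⁻ : ∀ a {b} → a ∨ b ≡ true → a ≡ true ⊎ b ≡ true
∨≡true⁻ true  _ = inj₁ refl
∨≡true⁻ false p = inj₂ p

∨≡trueˡ : ∀ {a} b → a ≡ true → a ∨ b ≡ true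
∨≡trueˡ b refl = refl

∨≡trueʳ : ∀ a {b} → b ≡ true → a ∨ b ≡ true
∨≡trueʳ true  _ = refl
∨≡trueʳ false p = p

∧≡true⁻ : ∀ a {b} → a ∧ b ≡ true → a ≡ true × b ≡ true
∧≡true⁻ true p = refl , p

∧≡true⁺ : ∀ {a b} → a ≡ true → b ≡ true → a ∧ b ≡ true
∧≡true⁺ refl refl = refl

≡true⇔⇒≡ : ∀ {a b} → (a ≡ true → b ≡ true) → (b ≡ true → a ≡ true) → a ≡ b
≡true⇔⇒≡ {true}  {true}  _ _ = refl
≡true⇔⇒≡ {true}  {false} f _ = ≡.sym (f refl)
≡true⇔⇒≡ {false} {true}  _ g = g refl
≡true⇔⇒≡ {false} {false} _ _ = refl

does≡true⇒ : ∀ {A : Set} (a? : Dec A) → does a? ≡ true → A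
does≡true⇒ (yes a) _ = a

any-allFin⁻ : ∀ {m} (f : Fin m → Bool) → any f (allFin m) ≡ true → ∃[ z ] f z ≡ true
any-allFin⁻ {m} f p =
  let z , fz = Any.satisfied (Any.any⁻ f (allFin m) (Equivalence.from Bool.T-≡ p))
  in z , Equivalence.to Bool.T-≡ fz

any-allFin⁺ : ∀ {m} (f : Fin m → Bool) z → f z ≡ true → any f (allFin m) ≡ true
any-allFin⁺ f z fz = Equivalence.to Bool.T-≡
  (Any.any⁺ f (Any.map (λ { refl → Equivalence.from Bool.T-≡ fz }) (∈-allFin z)))

module Reachability (G : Graph) where

  reach-zero⁻ : ∀ x y → reach G 0 x y ≡ true → x ≡ y
  reach-zero⁻ x y = does≡true⇒ (x ≟ y)

  reach-zero-refl : ∀ x → reach G 0 x x ≡ true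
  reach-zero-refl x = dec-true (x ≟ x) refl

  reach-suc⁻ : ∀ k x y → reach G (suc k) x y ≡ true →
    reach G k x y ≡ true ⊎ ∃[ z ] (adj G x z ≡ true × reach G k z y ≡ true)
  reach-suc⁻ k x y p with ∨≡true⁻ (reach G k x y) p
  ... | inj₁ q = inj₁ q
  ... | inj₂ q = let z , r = any-allFin⁻ _ q in inj₂ (z , ∧≡true⁻ (adj G x z) r)

  reach-suc⁺ : ∀ k x y → reach G k x y ≡ true → reach G (suc k) x y ≡ true
  reach-suc⁺ k x y = ∨≡trueˡ _

  reach-cons : ∀ k x z y → adj G x z ≡ true → reach G k z y ≡ true → reach G (suc k) x y ≡ true
  reach-cons k x z y a r =
    ∨≡trueʳ (reach G k x y) (any-allFin⁺ (λ w → adj G x w ∧ reach G k w y) z (∧≡true⁺ a r))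

  reach-refl : ∀ k x → reach G k x x ≡ true
  reach-refl zero    x = reach-zero-refl x
  reach-refl (suc k) x = reach-suc⁺ k x x (reach-refl k x)

  reach-mono : ∀ {k m} x y → k ≤ m → reach G k x y ≡ true → reach G m x y ≡ true
  reach-mono {m = m} x y z≤n p with reach-zero⁻ x y p
  ... | refl = reach-refl m x
  reach-mono {suc k} {suc m} x y (s≤s k≤m) p with reach-suc⁻ k x y p
  ... | inj₁ q = reach-suc⁺ m x y (reach-mono x y k≤m q)
  ... | inj₂ (z , a , q) = reach-cons m x z y a (reach-mono z y k≤m q)

  reach-snoc : ∀ k x y z → reach G k x y ≡ true → adj G y z ≡ true → reach G (suc k) x z ≡ true
  reach-snoc zero x y z p a with reach-zero⁻ x y p
  ... | refl = reach-cons 0 x z z a (reach-zero-refl z)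
  reach-snoc (suc k) x y z p a with reach-suc⁻ k x y p
  ... | inj₁ q = reach-suc⁺ (suc k) x z (reach-snoc k x y z q a)
  ... | inj₂ (w , aw , q) = reach-cons (suc k) x w z aw (reach-snoc k w y z q a)

  reach-sym : ∀ k x y → reach G k x y ≡ true → reach G k y x ≡ true
  reach-sym zero x y p with reach-zero⁻ x y p
  ... | refl = p
  reach-sym (suc k) x y p with reach-suc⁻ k x y p
  ... | inj₁ q = reach-suc⁺ k y x (reach-sym k x y q)
  ... | inj₂ (z , a , q) = reach-snoc k y z x (reach-sym k z y q) (trans (Graph.sym G z x) a)

  reach-comm : ∀ k x y → reach G k x y ≡ reach G k y x
  reach-comm k x y = ≡true⇔⇒≡ (reach-sym k x y) (reach-sym k y x)

  ReachStable : Fin (n G) → ℕ → Set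
  ReachStable y m = ∀ x → reach G (suc m) x y ≡ true → reach G m x y ≡ true

  reachStableAt? : ∀ y m x → Dec (reach G (suc m) x y ≡ true → reach G m x y ≡ true)
  reachStableAt? y m x = (reach G (suc m) x y Bool.≟ true) →-dec (reach G m x y Bool.≟ true)

  reachStable? : ∀ y m → Dec (ReachStable y m)
  reachStable? y m = Fin.all? (reachStableAt? y m)

  reachStable⇒saturated : ∀ y m → ReachStable y m →
    ∀ k x → reach G k x y ≡ true → reach G m x y ≡ true
  reachStable⇒saturated y m st zero x p = reach-mono {m = m} x y z≤n p
  reachStable⇒saturated y m st (suc k) x p with reach-suc⁻ k x y p
  ... | inj₁ q = reachStable⇒saturated y m st k x q
  ... | inj₂ (z , a , q) = st x (reach-cons m x z y a (reachStable⇒saturated y m st k z q))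

  ball : Fin (n G) → ℕ → Subset (n G)
  ball y k = tabulate λ x → reach G k x y

  ∈-ball⁺ : ∀ y k x → reach G k x y ≡ true → x ∈ ball y k
  ∈-ball⁺ y k x p = Vec.lookup⇒[]= x (ball y k) (trans (Vec.lookup∘tabulate _ x) p)

  ∈-ball⁻ : ∀ y k x → x ∈ ball y k → reach G k x y ≡ true
  ∈-ball⁻ y k x p = trans (≡.sym (Vec.lookup∘tabulate _ x)) (Vec.[]=⇒lookup p)

  unstable⇒ball⊂ : ∀ y k → ¬ ReachStable y k → ball y k ⊂ ball y (suc k)
  unstable⇒ball⊂ y k unstable
    with Fin.¬∀⟶∃¬ (n G) _ (reachStableAt? y k) unstable
  ... | x , ¬step =
    (λ {z} z∈ → ∈-ball⁺ y (suc k) z (reach-suc⁺ k z y (∈-ball⁻ y k z z∈))) ,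
    x , ∈-ball⁺ y (suc k) x reach-suc , λ x∈ → ¬step λ _ → ∈-ball⁻ y k x x∈
    where
      reach-suc : reach G (suc k) x y ≡ true
      reach-suc with reach G (suc k) x y
      ... | true  = refl
      ... | false = ⊥-elim (¬step λ ())

  stable-or-ball-large : ∀ y k → (∃[ m ] (m ≤ k × ReachStable y m)) ⊎ suc k ≤ ∣ ball y k ∣
  stable-or-ball-large y zero =
    inj₂ (ℕ.≤-trans (s≤s z≤n) (Subset.x∈p⇒∣p-x∣<∣p∣ (∈-ball⁺ y 0 y (reach-zero-refl y))))
  stable-or-ball-large y (suc k) with stable-or-ball-large y k | reachStable? y k
  ... | inj₁ (m , m≤k , st) | _      = inj₁ (m , ℕ.m≤n⇒m≤1+n m≤k , st)
  ... | inj₂ _              | yes st = inj₁ (k , ℕ.n≤1+n k , st)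
  ... | inj₂ large          | no ¬st =
    inj₂ (ℕ.<-≤-trans (s≤s large) (Subset.p⊂q⇒∣p∣<∣q∣ (unstable⇒ball⊂ y k ¬st)))

  -- The balls around y grow strictly until they stabilise for good, and have at most n elements.
  reach-within-order : Connected G → ∀ x y → reach G (n G) x y ≡ true
  reach-within-order connected x y with stable-or-ball-large y (n G)
  ... | inj₂ large = ⊥-elim (ℕ.<⇒≱ large (Subset.∣p∣≤n (ball y (n G))))
  ... | inj₁ (m , m≤n , st) =
    let k , p = connected x y in reach-mono x y m≤n (reachStable⇒saturated y m st k x p)

  distSearch-start : ∀ x y k f → reach G k x y ≡ true → distSearch G x y k f ≡ k
  distSearch-start x y k zero    p = refl
  distSearch-start x y k (suc f) p rewrite p = refl

  distSearch-found : ∀ x y k f → reach G (k + f) x y ≡ true →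
    reach G (distSearch G x y k f) x y ≡ true
  distSearch-found x y k zero p = subst (λ j → reach G j x y ≡ true) (ℕ.+-identityʳ k) p
  distSearch-found x y k (suc f) p with reach G k x y in found
  ... | true  = found
  ... | false = distSearch-found x y (suc k) f (subst (λ j → reach G j x y ≡ true) (ℕ.+-suc k f) p)

  distSearch-below : ∀ x y k f j → k ≤ j → j < distSearch G x y k f → reach G j x y ≡ false
  distSearch-below x y k zero j k≤j j< = ⊥-elim (ℕ.<⇒≱ j< k≤j)
  distSearch-below x y k (suc f) j k≤j j< with reach G k x y in found
  ... | true = ⊥-elim (ℕ.<⇒≱ j< k≤j)
  ... | false with k ℕ.≟ j
  ...   | yes refl = found
  ...   | no k≢j = distSearch-below x y (suc k) f j (ℕ.≤∧≢⇒< k≤j k≢j) j<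

  dist-refl : ∀ x → dist G x x ≡ 0
  dist-refl x = distSearch-start x x 0 (n G) (reach-zero-refl x)

  reach-dist : Connected G → ∀ x y → reach G (dist G x y) x y ≡ true
  reach-dist connected x y = distSearch-found x y 0 (n G) (reach-within-order connected x y)

  dist≡0⇒≡ : Connected G → ∀ x y → dist G x y ≡ 0 → x ≡ y
  dist≡0⇒≡ connected x y d =
    reach-zero⁻ x y (subst (λ j → reach G j x y ≡ true) d (reach-dist connected x y))

  dist≡1⇒adj : Connected G → ∀ x y → dist G x y ≡ 1 → adj G x y ≡ true
  dist≡1⇒adj connected x y d
    with reach-suc⁻ 0 x y (subst (λ j → reach G j x y ≡ true) d (reach-dist connected x y))
  ... | inj₂ (z , a , q) with reach-zero⁻ z y q
  ...   | refl = a
  dist≡1⇒adj connected x y d | inj₁ reach₀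
    with trans (≡.sym reach₀) (distSearch-below x y 0 (n G) 0 z≤n (subst (0 <_) (≡.sym d) (s≤s z≤n)))
  ... | ()

distSearch-shift : ∀ G H {a b : Fin (n H)} {x y : Fin (n G)} →
  (∀ j → reach H (suc j) a b ≡ reach G j x y) →
  ∀ k f → distSearch H a b (suc k) f ≡ suc (distSearch G x y k f)
distSearch-shift G H eq k zero = refl
distSearch-shift G H {a = a} {b} {x} {y} eq k (suc f)
  with reach H (suc k) a b in h | reach G k x y in g
... | true  | true  = refl
... | false | false = distSearch-shift G H eq (suc k) f
... | true  | false with () ← trans (≡.sym h) (trans (eq k) g)
... | false | true  with () ← trans (≡.sym g) (trans (≡.sym (eq k)) h)

if-cong : ∀ {A : Set} {b c : Bool} {t e₁ e₂ : A} →
  b ≡ c → (c ≡ false → e₁ ≡ e₂) → (if b then t else e₁) ≡ (if c then t else e₂)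
if-cong {c = true}  refl _ = refl
if-cong {c = false} refl h = h refl

distSearch-extraFuel : ∀ G H {a b : Fin (n H)} {x y : Fin (n G)} →
  (∀ j → reach H j a b ≡ reach G j x y) →
  ∀ k f → reach G (k + f) x y ≡ true → distSearch H a b k (suc f) ≡ distSearch G x y k f
distSearch-extraFuel G H {x = x} {y} eq k zero p
  rewrite eq k | subst (λ j → reach G j x y ≡ true) (ℕ.+-identityʳ k) p = refl
distSearch-extraFuel G H {x = x} {y} eq k (suc f) p = if-cong (eq k) λ _ →
  distSearch-extraFuel G H eq (suc k) f (subst (λ j → reach G j x y ≡ true) (ℕ.+-suc k f) p)

∣p∪⁅x⁆∣≤1+∣p∣ : ∀ {m} (p : Subset m) (x : Fin m) → ∣ p ∪ ⁅ x ⁆ ∣ ≤ suc ∣ p ∣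
∣p∪⁅x⁆∣≤1+∣p∣ (true  ∷ p) zero    rewrite Subset.∪-identityʳ p = ℕ.n≤1+n _
∣p∪⁅x⁆∣≤1+∣p∣ (false ∷ p) zero    rewrite Subset.∪-identityʳ p = ℕ.≤-refl
∣p∪⁅x⁆∣≤1+∣p∣ (true  ∷ p) (suc x) = s≤s (∣p∪⁅x⁆∣≤1+∣p∣ p x)
∣p∪⁅x⁆∣≤1+∣p∣ (false ∷ p) (suc x) = ∣p∪⁅x⁆∣≤1+∣p∣ p x

resolving? : ∀ G (S : Subset (n G)) → Dec (Resolving G S)
resolving? G S = Fin.all? λ x → Fin.all? λ y → ¬? (x ≟ y) →-dec
  Fin.any? λ s → (s Subset.∈? S) ×-dec ¬? (dist G s x ℕ.≟ dist G s y)

⊤-resolving : ∀ G → Connected G → Resolving G ⊤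
⊤-resolving G connected x y x≢y =
  x , Subset.∈⊤ , λ d → x≢y (dist≡0⇒≡ connected x y (trans (≡.sym d) (dist-refl x)))
  where open Reachability G

metricBasis-below : ∀ G m (S : Subset (n G)) → ∣ S ∣ ≤ m → Resolving G S →
  Σ (Subset (n G)) (MetricBasis G)
metricBasis-below G zero S ∣S∣≤0 rS = S , rS , λ T _ → ℕ.≤-trans ∣S∣≤0 z≤n
metricBasis-below G (suc m) S ∣S∣≤m rS
  with Subset.anySubset? (λ T → resolving? G T ×-dec (suc ∣ T ∣ ℕ.≤? ∣ S ∣))
... | yes (T , rT , ∣T∣<∣S∣) = metricBasis-below G m T (ℕ.≤-pred (ℕ.≤-trans ∣T∣<∣S∣ ∣S∣≤m)) rT
... | no noSmaller = S , rS , λ T rT → ℕ.≮⇒≥ λ ∣T∣<∣S∣ → noSmaller (T , rT , ∣T∣<∣S∣)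

metricBasis-exists : ∀ G → Connected G → Σ (Subset (n G)) (MetricBasis G)
metricBasis-exists G connected = metricBasis-below G _ ⊤ ℕ.≤-refl (⊤-resolving G connected)

module Pendant (G : Graph) (v : Fin (n G)) where

  H : Graph
  H = addPendant G v

  open Reachability G
  module InH = Reachability H

  reach-new-suc⇒reach-v : ∀ k y →
    reach H (suc k) zero (suc y) ≡ true → reach H k (suc v) (suc y) ≡ true
  reach-new-suc⇒reach-v k y p with InH.reach-suc⁻ k zero (suc y) p
  reach-new-suc⇒reach-v zero    y p | inj₁ ()
  reach-new-suc⇒reach-v (suc k) y p | inj₁ q =
    InH.reach-suc⁺ k (suc v) (suc y) (reach-new-suc⇒reach-v k y q)
  reach-new-suc⇒reach-v k       y p | inj₂ (suc z , a , q) with does≡true⇒ (z ≟ v) a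
  ... | refl = q

  reach-new⇒reach-v : ∀ k y → reach H k zero (suc y) ≡ true → reach H k (suc v) (suc y) ≡ true
  reach-new⇒reach-v zero    y ()
  reach-new⇒reach-v (suc k) y p = InH.reach-suc⁺ k (suc v) (suc y) (reach-new-suc⇒reach-v k y p)

  reach-old-old⇒ : ∀ k x y → reach H k (suc x) (suc y) ≡ true → reach G k x y ≡ true
  reach-old-old⇒ zero x y p with InH.reach-zero⁻ (suc x) (suc y) p
  ... | refl = reach-zero-refl x
  reach-old-old⇒ (suc k) x y p with InH.reach-suc⁻ k (suc x) (suc y) p
  ... | inj₁ q = reach-suc⁺ k x y (reach-old-old⇒ k x y q)
  ... | inj₂ (suc z , a , q) = reach-cons k x z y a (reach-old-old⇒ k z y q)
  ... | inj₂ (zero , a , q) with does≡true⇒ (x ≟ v) a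
  ...   | refl = reach-suc⁺ k v y (reach-old-old⇒ k v y (reach-new⇒reach-v k y q))

  reach-old-old⇐ : ∀ k x y → reach G k x y ≡ true → reach H k (suc x) (suc y) ≡ true
  reach-old-old⇐ zero x y p with reach-zero⁻ x y p
  ... | refl = InH.reach-zero-refl (suc x)
  reach-old-old⇐ (suc k) x y p with reach-suc⁻ k x y p
  ... | inj₁ q = InH.reach-suc⁺ k (suc x) (suc y) (reach-old-old⇐ k x y q)
  ... | inj₂ (z , a , q) = InH.reach-cons k (suc x) (suc z) (suc y) a (reach-old-old⇐ k z y q)

  reach-old-old : ∀ k x y → reach H k (suc x) (suc y) ≡ reach G k x y
  reach-old-old k x y = ≡true⇔⇒≡ (reach-old-old⇒ k x y) (reach-old-old⇐ k x y)

  reach-new-old : ∀ k y → reach H (suc k) zero (suc y) ≡ reach G k v y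
  reach-new-old k y = ≡true⇔⇒≡
    (λ p → reach-old-old⇒ k v y (reach-new-suc⇒reach-v k y p))
    (λ p → InH.reach-cons k zero (suc v) (suc y) (dec-true (v ≟ v) refl) (reach-old-old⇐ k v y p))

  reach-old-new : ∀ k x → reach H (suc k) (suc x) zero ≡ reach G k x v
  reach-old-new k x = begin
    reach H (suc k) (suc x) zero ≡⟨ InH.reach-comm (suc k) (suc x) zero ⟩
    reach H (suc k) zero (suc x) ≡⟨ reach-new-old k x ⟩
    reach G k v x                ≡⟨ reach-comm k v x ⟩
    reach G k x v                ∎
    where open ≡.≡-Reasoning

  dist-new-old : ∀ y → dist H zero (suc y) ≡ suc (dist G v y)
  dist-new-old y = distSearch-shift G H (λ j → reach-new-old j y) 0 (n G)

  dist-old-new : ∀ x → dist H (suc x) zero ≡ suc (dist G x v)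
  dist-old-new x = distSearch-shift G H (λ j → reach-old-new j x) 0 (n G)

  dist-old-old : Connected G → ∀ x y → dist H (suc x) (suc y) ≡ dist G x y
  dist-old-old connected x y =
    distSearch-extraFuel G H (λ j → reach-old-old j x y) 0 (n G) (reach-within-order connected x y)

  Mimics : Subset (n G) → Fin (n G) → Set
  Mimics R w = ∀ r → r ∈ R → dist H (suc r) (suc w) ≡ dist H (suc r) zero

  mimicsAt? : ∀ R w r → Dec (r ∈ R → dist H (suc r) (suc w) ≡ dist H (suc r) zero)
  mimicsAt? R w r = (r Subset.∈? R) →-dec (dist H (suc r) (suc w) ℕ.≟ dist H (suc r) zero)

  HasMimicNeighbour : Subset (n G) → Set
  HasMimicNeighbour R = ∃[ w ] (adj G v w ≡ true × Mimics R w)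

  hasMimicNeighbour? : ∀ R → Dec (HasMimicNeighbour R)
  hasMimicNeighbour? R = Fin.any? λ w → (adj G v w Bool.≟ true) ×-dec Fin.all? (mimicsAt? R w)

  mimics⇒¬resolving : ∀ {S w} → Mimics S w → ¬ Resolving H (false ∷ S)
  mimics⇒¬resolving {S} {w} mimics rS with rS zero (suc w) (λ ())
  ... | suc r , there r∈S , d≢ = d≢ (≡.sym (mimics r r∈S))

  collapseNew : Subset (n H) → Subset (n G)
  collapseNew (true  ∷ p) = p ∪ ⁅ v ⁆
  collapseNew (false ∷ p) = p

  ∣collapseNew∣≤ : ∀ T → ∣ collapseNew T ∣ ≤ ∣ T ∣
  ∣collapseNew∣≤ (true  ∷ p) = ∣p∪⁅x⁆∣≤1+∣p∣ p v
  ∣collapseNew∣≤ (false ∷ p) = ℕ.≤-refl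

  module _ (connected : Connected G) where

    private
      dist-old = dist-old-old connected

    resolving-collapseNew : ∀ T → Resolving H T → Resolving G (collapseNew T)
    resolving-collapseNew (false ∷ p) rT x y x≢y with rT (suc x) (suc y) (x≢y ∘ Fin.suc-injective)
    ... | suc r , there r∈p , d≢ = r , r∈p , ≡.subst₂ _≢_ (dist-old r x) (dist-old r y) d≢
    resolving-collapseNew (true ∷ p) rT x y x≢y with rT (suc x) (suc y) (x≢y ∘ Fin.suc-injective)
    ... | zero , here , d≢ =
      v , Subset.x∈p∪q⁺ (inj₂ (Subset.x∈⁅x⁆ v)) ,
      ≡.subst₂ _≢_ (dist-new-old x) (dist-new-old y) d≢ ∘ cong suc
    ... | suc r , there r∈p , d≢ =
      r , Subset.x∈p∪q⁺ (inj₁ r∈p) , ≡.subst₂ _≢_ (dist-old r x) (dist-old r y) d≢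

    resolving-exchange : ∀ R → Resolving G R → Resolving H (true ∷ (R - v))
    resolving-exchange R rR zero    zero    u≢u = ⊥-elim (u≢u refl)
    resolving-exchange R rR zero    (suc y) _   =
      zero , here , λ d → ℕ.0≢1+n (trans d (dist-new-old y))
    resolving-exchange R rR (suc x) zero    _   =
      zero , here , λ d → ℕ.0≢1+n (trans (≡.sym d) (dist-new-old x))
    resolving-exchange R rR (suc x) (suc y) x≢y with rR x y (x≢y ∘ cong suc)
    ... | r , r∈R , d≢ with r ≟ v
    ...   | yes refl = zero , here ,
                       ≡.subst₂ _≢_ (≡.sym (dist-new-old x)) (≡.sym (dist-new-old y)) (d≢ ∘ ℕ.suc-injective)
    ...   | no r≢v = suc r , there (Subset.x∈p∧x≢y⇒x∈p-y r∈R r≢v) ,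
                     ≡.subst₂ _≢_ (≡.sym (dist-old r x)) (≡.sym (dist-old r y)) d≢

    -- v sees the new vertex at distance 1, so only the neighbours of v need another witness.
    new-separated : ∀ R → v ∈ R → ¬ HasMimicNeighbour R → ∀ x →
      ∃[ s ] (s ∈ (false ∷ R) × dist H s zero ≢ dist H s (suc x))
    new-separated R v∈R noMimic x with dist G v x ℕ.≟ 1
    ... | no d≢1 = suc v , there v∈R , λ d → d≢1 (begin
      dist G v x             ≡⟨ dist-old v x ⟨
      dist H (suc v) (suc x) ≡⟨ d ⟨
      dist H (suc v) zero    ≡⟨ dist-old-new v ⟩
      suc (dist G v v)       ≡⟨ cong suc (dist-refl v) ⟩
      1                      ∎)
      where open ≡.≡-Reasoning
    ... | yes d≡1 with Fin.¬∀⟶∃¬ (n G) _ (mimicsAt? R x)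
                         (λ mimics → noMimic (x , dist≡1⇒adj connected v x d≡1 , mimics))
    ... | r , ¬mimic with r Subset.∈? R
    ...   | yes r∈R = suc r , there r∈R , ¬mimic ∘ const ∘ ≡.sym
    ...   | no r∉R  = ⊥-elim (¬mimic (⊥-elim ∘ r∉R))

    resolving-lift : ∀ R → Resolving G R → v ∈ R → ¬ HasMimicNeighbour R → Resolving H (false ∷ R)
    resolving-lift R rR v∈R noMimic zero    zero    u≢u = ⊥-elim (u≢u refl)
    resolving-lift R rR v∈R noMimic zero    (suc y) _   = new-separated R v∈R noMimic y
    resolving-lift R rR v∈R noMimic (suc x) zero    _   =
      let s , s∈ , d≢ = new-separated R v∈R noMimic x in s , s∈ , d≢ ∘ ≡.sym
    resolving-lift R rR v∈R noMimic (suc x) (suc y) x≢y with rR x y (x≢y ∘ cong suc)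
    ... | r , r∈R , d≢ =
      suc r , there r∈R , ≡.subst₂ _≢_ (≡.sym (dist-old r x)) (≡.sym (dist-old r y)) d≢

    metricBasis-lift : ∀ R → MetricBasis G R → v ∈ R → ¬ HasMimicNeighbour R →
      MetricBasis H (false ∷ R)
    metricBasis-lift R (rR , minR) v∈R noMimic =
      resolving-lift R rR v∈R noMimic ,
      λ T rT → ℕ.≤-trans (minR _ (resolving-collapseNew T rT)) (∣collapseNew∣≤ T)

    -- A basis B of G contains v, and B - v + u resolves H; hence dim H ≤ dim G.
    metricBasis-restrict : BasisForced G v → ∀ S → MetricBasis H (false ∷ S) → MetricBasis G S
    metricBasis-restrict forced S (rS , minS) =
      let B , basisB@(rB , minB) = metricBasis-exists G connected in
      resolving-collapseNew (false ∷ S) rS ,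
      λ T rT → ℕ.≤-trans (minS _ (resolving-exchange B rB))
                 (ℕ.≤-trans (Subset.x∈p⇒∣p-x∣<∣p∣ (forced B basisB)) (minB T rT))

mainTheorem2 : (G : Graph) → Connected G → (v : Fin (n G)) → BasisForced G v →
    BasisForced (addPendant G v) (newVertex G v)
    ⇔ (∀ R → MetricBasis G R →
        Σ[ w ∈ Fin (n G) ] (adj G v w ≡ true ×
          (∀ r → r ∈ R → dist (addPendant G v) (old G v r) (old G v w)
                          ≡ dist (addPendant G v) (old G v r) (newVertex G v))))
mainTheorem2 G connected v forced = mk⇔ newForced⇒mimic mimic⇒newForced
  where
    open Pendant G v

    newForced⇒mimic : BasisForced H zero → ∀ R → MetricBasis G R → HasMimicNeighbour R
    newForced⇒mimic newForced R basisR with hasMimicNeighbour? R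
    ... | yes found = found
    ... | no none with newForced (false ∷ R) (metricBasis-lift connected R basisR (forced R basisR) none)
    ...   | ()

    mimic⇒newForced : (∀ R → MetricBasis G R → HasMimicNeighbour R) → BasisForced H zero
    mimic⇒newForced mimic (true  ∷ S) _      = here
    mimic⇒newForced mimic (false ∷ S) basisS =
      let w , _ , mimics = mimic S (metricBasis-restrict connected forced S basisS)
      in ⊥-elim (mimics⇒¬resolving mimics (proj₁ basisS))
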